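{- Let $K$ be a field of characteristic not $2$, let $V$ be an $n$-dimensional $K$-vector space with basis $(\varepsilon_1,\dots,\varepsilon_n)$, let $R=K[t_{i,j}]_{1\le i\le j\le n}$ be the polynomial ring in $\frac{n(n+1)}2$ variables, and equip $V$ with the symmetric bilinear form with values in $R$ determined by $\varepsilon_i\cdot\varepsilon_j=\varepsilon_j\cdot\varepsilon_i=t_{i,j}$ for $i\le j$. Let $(e_1,\dots,e_p)$ and $(e'_1,\dots,e'_{p'})$ be systems of vectors of $V$ and $\lambda_i,\lambda'_j\in K$. Then the relations $$\sum_{i=1}^p\lambda_iN(e_i)=\sum_{j=1}^{p'}\lambda'_jN(e'_j)\quad\text{and}\quad\sum_{i=1}^p\lambda_iN(e_i)\,p_{e_i}=\sum_{j=1}^{p'}\lambda'_jN(e'_j)\,p_{e'_j}$$ are equivalent.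
   Context: $N(x)=x\cdot x\in R$, and $N(x)\,p_x$ denotes the $R$-linear map $y\mapsto(x\cdot y)\,x$ (i.e. $N(x)$ times the orthogonal projection onto $x$ with respect to the given bilinear form). -}

module Defs where

open import Level using (Level; _⊔_) renaming (suc to lsuc)
open import Algebra.Bundles using (CommutativeRing)
open import Data.Nat using (ℕ)
import Data.Nat as ℕ
open import Data.Nat.Properties using () renaming (_≟_ to _≟ℕ_)
open import Data.Fin using (Fin; zero; suc; toℕ)
open import Data.Vec using (Vec; replicate; zipWith; updateAt)
open import Data.Vec.Properties using (≡-dec)
open import Data.List using (List; []; _∷_; _++_; map; concatMap)
open import Data.Product using (_×_; _,_; ∃)
open import Relation.Nullary using (¬_; yes; no)
open import Relation.Nullary.Decidable using (Dec)
open import Relation.Binary.PropositionalEquality using (_≡_)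

record Field (c ℓ : Level) : Set (lsuc (c ⊔ ℓ)) where
  field
    commutativeRing : CommutativeRing c ℓ
  open CommutativeRing commutativeRing public
  field
    0≉1     : ¬ (0# ≈ 1#)
    inverse : ∀ x → ¬ (x ≈ 0#) → ∃ λ y → (x * y) ≈ 1#

module Setup {c ℓ} (K : Field c ℓ) (n : ℕ) where
  open Field K using (Carrier; _≈_; _+_; _*_; 0#; 1#)

  CharNot2 : Set ℓ
  CharNot2 = ¬ ((1# + 1#) ≈ 0#)

  -- A monomial is an exponent table indexed by pairs (i , j); only the
  -- entries with i ≤ j are ever nonzero (the variables are t_{i,j}, i ≤ j).
  Monomial : Set
  Monomial = Vec (Vec ℕ n) n

  _≟M_ : (m m' : Monomial) → Dec (m ≡ m')
  _≟M_ = ≡-dec (≡-dec _≟ℕ_)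

  oneM : Monomial
  oneM = replicate n (replicate n 0)

  _·M_ : Monomial → Monomial → Monomial
  _·M_ = zipWith (zipWith ℕ._+_)

  R : Set c
  R = List (Carrier × Monomial)

  coeff : R → Monomial → Carrier
  coeff []             m = 0#
  coeff ((a , m') ∷ p) m with m' ≟M m
  ... | yes _ = a + coeff p m
  ... | no  _ = coeff p m

  infix 4 _≈R_
  _≈R_ : R → R → Set ℓ
  p ≈R q = ∀ m → coeff p m ≈ coeff q m

  0R : R
  0R = []

  infixl 6 _+R_
  _+R_ : R → R → R
  _+R_ = _++_

  infixl 7 _*R_
  _*R_ : R → R → R
  p *R q = concatMap (λ { (a , m) → map (λ { (b , m') → (a * b , m ·M m') }) q }) p

  infixl 7 _•R_
  _•R_ : Carrier → R → R
  a •R p = map (λ { (b , m) → (a * b , m) }) p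

  t : Fin n → Fin n → R
  t i j = (1# , updateAt oneM i (λ row → updateAt row j (λ _ → 1))) ∷ []

  tSym : Fin n → Fin n → R
  tSym i j with toℕ i ℕ.≤? toℕ j
  ... | yes _ = t i j
  ... | no  _ = t j i

  ΣR : ∀ {p} → (Fin p → R) → R
  ΣR {ℕ.zero}  f = 0R
  ΣR {ℕ.suc p} f = f zero +R ΣR (λ i → f (suc i))

  -- V = K^n with basis ε_1..ε_n (coordinates), and R ⊗ V = R^n.
  V : Set c
  V = Fin n → Carrier

  RV : Set c
  RV = Fin n → R

  infix 8 _·_
  _·_ : V → V → R
  x · y = ΣR λ k → ΣR λ l → (x k * y l) •R tSym k l

  N : V → R
  N x = x · x

  -- N(x) p_x : y ↦ (x · y) x, an R-linear map V → R ⊗ V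
  Np : V → V → RV
  Np x y k = x k •R (x · y)

  infix 4 _≈Map_
  _≈Map_ : (V → RV) → (V → RV) → Set (c ⊔ ℓ)
  f ≈Map g = ∀ y k → f y k ≈R g y k

  ΣN : ∀ {p} → (Fin p → Carrier) → (Fin p → V) → R
  ΣN λs e = ΣR λ i → λs i •R N (e i)

  ΣNp : ∀ {p} → (Fin p → Carrier) → (Fin p → V) → (V → RV)
  ΣNp λs e y k = ΣR λ i → λs i •R Np (e i) y k

-- Both relations depend on the data (λᵢ, eᵢ) only through the symmetric Gram
-- matrix G_{kl} = Σᵢ λᵢ e_{ik} e_{il}, and each of them determines G.  The
-- coefficient of t_{kl} in Σᵢ λᵢ N(eᵢ) is G_{kk} if k = l and 2 G_{kl}
-- otherwise, so the first relation recovers G because 2 is invertible.  The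
-- k-th coordinate of Σᵢ λᵢ N(eᵢ) p_{eᵢ} applied to ε_a has coefficient G_{ka}
-- at t_{aa}, so the second relation recovers G as well.
module Submission where

open import Defs
open import Level using (Level)
open import Data.Nat using (ℕ)
open import Data.Fin using (Fin; zero; suc; toℕ; _≟_)
open import Function.Bundles using (_⇔_; mk⇔)

import Data.Nat as ℕ
import Data.Nat.Properties as ℕ
open import Data.Fin.Properties using (toℕ-injective)
open import Data.Vec using (lookup; replicate; updateAt)
open import Data.Vec.Properties using (lookup∘updateAt; lookup∘updateAt′; lookup-replicate)
open import Data.List using ([]; _∷_; _++_)
open import Data.Product using (_×_; _,_)
open import Data.Sum using (_⊎_; inj₁; inj₂)
open import Relation.Nullary using (¬_; yes; no)
open import Relation.Nullary.Negation using (contradiction)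
open import Relation.Binary.PropositionalEquality as ≡ using (_≡_; _≢_; ≢-sym)
open import Algebra.Bundles using (CommutativeSemiring)
import Algebra.Properties.Semiring.Sum as SemiringSum
import Relation.Binary.Reasoning.Setoid as SetoidReasoning

module KroneckerDelta {c ℓ} (S : CommutativeSemiring c ℓ) where
  open CommutativeSemiring S hiding (zero)
  open SemiringSum semiring using (sum; sum-cong-≋; sum-replicate-zero; *-distribʳ-sum)
  open SetoidReasoning setoid

  δ : ∀ {m} → Fin m → Fin m → Carrier
  δ zero    zero    = 1#
  δ zero    (suc k) = 0#
  δ (suc a) zero    = 0#
  δ (suc a) (suc k) = δ a k

  δ-diag : ∀ {m} (a : Fin m) → δ a a ≡ 1#
  δ-diag zero    = ≡.refl
  δ-diag (suc a) = δ-diag a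

  δ-off : ∀ {m} {a k : Fin m} → a ≢ k → δ a k ≈ 0#
  δ-off {a = zero}  {zero}  a≢k = contradiction ≡.refl a≢k
  δ-off {a = zero}  {suc k} a≢k = refl
  δ-off {a = suc a} {zero}  a≢k = refl
  δ-off {a = suc a} {suc k} a≢k = δ-off (λ a≡k → a≢k (≡.cong suc a≡k))

  δ*δ-off : ∀ {m} (a k b l : Fin m) → ¬ (a ≡ k × b ≡ l) → δ a k * δ b l ≈ 0#
  δ*δ-off a k b l ¬eq with a ≟ k | b ≟ l
  ... | no a≢k    | _         = trans (*-congʳ (δ-off a≢k)) (zeroˡ _)
  ... | yes _     | no b≢l    = trans (*-congˡ (δ-off b≢l)) (zeroʳ _)
  ... | yes a≡k   | yes b≡l   = contradiction (a≡k , b≡l) ¬eq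

  δ*δ-diag : ∀ {m} (a b : Fin m) → δ a a * δ b b ≈ 1#
  δ*δ-diag a b = trans (*-cong (reflexive (δ-diag a)) (reflexive (δ-diag b))) (*-identityˡ 1#)

  ∑-δ : ∀ {m} (f : Fin m → Carrier) a → sum (λ k → f k * δ a k) ≈ f a
  ∑-δ {ℕ.suc m} f zero = begin
    f zero * 1# + sum (λ k → f (suc k) * 0#) ≈⟨ +-cong (*-identityʳ _) (sum-cong-≋ λ k → zeroʳ (f (suc k))) ⟩
    f zero + sum {m} (λ _ → 0#)              ≈⟨ +-congˡ (sum-replicate-zero m) ⟩
    f zero + 0#                              ≈⟨ +-identityʳ _ ⟩
    f zero                                   ∎
  ∑-δ {ℕ.suc m} f (suc a) = trans (+-cong (zeroʳ _) (∑-δ (λ k → f (suc k)) a)) (+-identityˡ _)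

  ∑∑-δ*δ : ∀ {m} (g : Fin m → Fin m → Carrier) a b →
           sum (λ k → sum (λ l → g k l * (δ a k * δ b l))) ≈ g a b
  ∑∑-δ*δ g a b = begin
    sum (λ k → sum (λ l → g k l * (δ a k * δ b l)))
      ≈⟨ sum-cong-≋ (λ k → sum-cong-≋ λ l → trans (*-congˡ (*-comm (δ a k) (δ b l))) (sym (*-assoc (g k l) (δ b l) (δ a k)))) ⟩
    sum (λ k → sum (λ l → (g k l * δ b l) * δ a k))
      ≈⟨ sum-cong-≋ (λ k → sym (*-distribʳ-sum (δ a k) (λ l → g k l * δ b l))) ⟩
    sum (λ k → sum (λ l → g k l * δ b l) * δ a k)
      ≈⟨ sum-cong-≋ (λ k → *-congʳ (∑-δ (g k) b)) ⟩
    sum (λ k → g k b * δ a k)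
      ≈⟨ ∑-δ (λ k → g k b) a ⟩
    g a b ∎

module GramMatrix {c ℓ} (K : Field c ℓ) (n : ℕ) where
  open Setup K n
  open Field K hiding (zero)
  open SemiringSum semiring using (sum; sum-cong-≋; ∑-comm; ∑-distrib-+; *-distribˡ-sum; *-distribʳ-sum)
  open KroneckerDelta commutativeSemiring
  open SetoidReasoning setoid

  double-injective : CharNot2 → ∀ {x y} → x + x ≈ y + y → x ≈ y
  double-injective ch {x} {y} x+x≈y+y with inverse (1# + 1#) ch
  ... | w , 2w≈1 = trans (halve x) (trans (*-congˡ x+x≈y+y) (sym (halve y)))
    where
    halve : ∀ z → z ≈ w * (z + z)
    halve z = begin
      z                     ≈⟨ sym (*-identityˡ z) ⟩
      1# * z                ≈⟨ *-congʳ (sym (trans (*-comm w _) 2w≈1)) ⟩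
      (w * (1# + 1#)) * z   ≈⟨ *-assoc w _ z ⟩
      w * ((1# + 1#) * z)   ≈⟨ *-congˡ (trans (distribʳ z 1# 1#) (+-cong (*-identityˡ z) (*-identityˡ z))) ⟩
      w * (z + z)           ∎

  coeff-++ : ∀ (p q : R) m → coeff (p ++ q) m ≈ coeff p m + coeff q m
  coeff-++ [] q m = sym (+-identityˡ _)
  coeff-++ ((a , m') ∷ p) q m with m' ≟M m
  ... | yes _ = trans (+-congˡ (coeff-++ p q m)) (sym (+-assoc _ _ _))
  ... | no  _ = coeff-++ p q m

  coeff-•R : ∀ a (p : R) m → coeff (a •R p) m ≈ a * coeff p m
  coeff-•R a [] m = sym (zeroʳ a)
  coeff-•R a ((b , m') ∷ p) m with m' ≟M m
  ... | yes _ = trans (+-congˡ (coeff-•R a p m)) (sym (distribˡ a b _))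
  ... | no  _ = coeff-•R a p m

  coeff-ΣR : ∀ {p} (f : Fin p → R) m → coeff (ΣR f) m ≈ sum (λ i → coeff (f i) m)
  coeff-ΣR {ℕ.zero}  f m = refl
  coeff-ΣR {ℕ.suc p} f m = trans (coeff-++ (f zero) _ m) (+-congˡ (coeff-ΣR (λ i → f (suc i)) m))

  var : Fin n → Fin n → Monomial
  var i j = updateAt oneM i (λ row → updateAt row j (λ _ → 1))

  entry : Monomial → Fin n → Fin n → ℕ
  entry A r s = lookup (lookup A r) s

  entry-oneM : ∀ r s → entry oneM r s ≡ 0
  entry-oneM r s rewrite lookup-replicate r (replicate n 0) = lookup-replicate s 0

  entry-var-self : ∀ i j → entry (var i j) i j ≡ 1
  entry-var-self i j rewrite lookup∘updateAt i {λ row → updateAt row j (λ _ → 1)} oneM =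
    lookup∘updateAt j (lookup oneM i)

  entry-var≡1 : ∀ i j r s → entry (var i j) r s ≡ 1 → r ≡ i × s ≡ j
  entry-var≡1 i j r s h with r ≟ i
  ... | no r≢i rewrite lookup∘updateAt′ r i {λ row → updateAt row j (λ _ → 1)} r≢i oneM
                     | entry-oneM r s = contradiction h λ ()
  ... | yes ≡.refl with s ≟ j
  ...   | yes s≡j = ≡.refl , s≡j
  ...   | no  s≢j rewrite lookup∘updateAt r {λ row → updateAt row j (λ _ → 1)} oneM
                        | lookup∘updateAt′ s j {λ _ → 1} s≢j (lookup oneM r)
                        | entry-oneM r s = contradiction h λ ()

  var-injective : ∀ {i j i' j'} → var i j ≡ var i' j' → i ≡ i' × j ≡ j'
  var-injective {i} {j} {i'} {j'} eq =
    entry-var≡1 i' j' i j (≡.subst (λ A → entry A i j ≡ 1) eq (entry-var-self i j))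

  tMono : Fin n → Fin n → Monomial
  tMono k l with toℕ k ℕ.≤? toℕ l
  ... | yes _ = var k l
  ... | no  _ = var l k

  tSym≡ : ∀ k l → tSym k l ≡ (1# , tMono k l) ∷ []
  tSym≡ k l with toℕ k ℕ.≤? toℕ l
  ... | yes _ = ≡.refl
  ... | no  _ = ≡.refl

  tMono-cases : ∀ k l → tMono k l ≡ var k l ⊎ tMono k l ≡ var l k
  tMono-cases k l with toℕ k ℕ.≤? toℕ l
  ... | yes _ = inj₁ ≡.refl
  ... | no  _ = inj₂ ≡.refl

  tMono-sym : ∀ k l → tMono k l ≡ tMono l k
  tMono-sym k l with toℕ k ℕ.≤? toℕ l | toℕ l ℕ.≤? toℕ k
  ... | yes k≤l | yes l≤k rewrite toℕ-injective (ℕ.≤-antisym k≤l l≤k) = ≡.refl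
  ... | yes _   | no  _   = ≡.refl
  ... | no  _   | yes _   = ≡.refl
  ... | no  k≰l | no  l≰k with ℕ.≤-total (toℕ k) (toℕ l)
  ...   | inj₁ k≤l = contradiction k≤l k≰l
  ...   | inj₂ l≤k = contradiction l≤k l≰k

  tMono-injective : ∀ {k l a b} → tMono k l ≡ tMono a b → (k ≡ a × l ≡ b) ⊎ (k ≡ b × l ≡ a)
  tMono-injective {k} {l} {a} {b} eq with tMono-cases k l | tMono-cases a b
  ... | inj₁ e₁ | inj₁ e₂ = inj₁ (var-injective (≡.trans (≡.sym e₁) (≡.trans eq e₂)))
  ... | inj₂ e₁ | inj₂ e₂ with var-injective (≡.trans (≡.sym e₁) (≡.trans eq e₂))
  ...   | l≡b , k≡a = inj₁ (k≡a , l≡b)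
  tMono-injective eq | inj₁ e₁ | inj₂ e₂ = inj₂ (var-injective (≡.trans (≡.sym e₁) (≡.trans eq e₂)))
  tMono-injective eq | inj₂ e₁ | inj₁ e₂ with var-injective (≡.trans (≡.sym e₁) (≡.trans eq e₂))
  ...   | l≡a , k≡b = inj₂ (k≡b , l≡a)

  coeff-tSym-≡ : ∀ k l {m} → tMono k l ≡ m → coeff (tSym k l) m ≈ 1#
  coeff-tSym-≡ k l {m} eq rewrite tSym≡ k l with tMono k l ≟M m
  ... | yes _   = +-identityʳ 1#
  ... | no  ≢m  = contradiction eq ≢m

  coeff-tSym-≢ : ∀ k l {m} → tMono k l ≢ m → coeff (tSym k l) m ≈ 0#
  coeff-tSym-≢ k l {m} ne rewrite tSym≡ k l with tMono k l ≟M m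
  ... | yes eq = contradiction eq ne
  ... | no  _  = refl

  coeff-tSym-diag : ∀ a k l → coeff (tSym k l) (tMono a a) ≈ δ a k * δ a l
  coeff-tSym-diag a k l with tMono k l ≟M tMono a a
  ... | no ne = trans (coeff-tSym-≢ k l ne) (sym (δ*δ-off a k a l λ { (≡.refl , ≡.refl) → ne ≡.refl }))
  ... | yes eq with tMono-injective {k} {l} {a} {a} eq
  ...   | inj₁ (≡.refl , ≡.refl) = trans (coeff-tSym-≡ k l eq) (sym (δ*δ-diag a a))
  ...   | inj₂ (≡.refl , ≡.refl) = trans (coeff-tSym-≡ k l eq) (sym (δ*δ-diag a a))

  coeff-tSym-off : ∀ {a b} → a ≢ b → ∀ k l →
                   coeff (tSym k l) (tMono a b) ≈ δ a k * δ b l + δ b k * δ a l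
  coeff-tSym-off {a} {b} a≢b k l with tMono k l ≟M tMono a b
  ... | no ne = trans (coeff-tSym-≢ k l ne) (sym (trans
        (+-cong (δ*δ-off a k b l λ { (≡.refl , ≡.refl) → ne ≡.refl })
                (δ*δ-off b k a l λ { (≡.refl , ≡.refl) → ne (tMono-sym b a) }))
        (+-identityʳ 0#)))
  ... | yes eq with tMono-injective {k} {l} {a} {b} eq
  ...   | inj₁ (≡.refl , ≡.refl) = trans (coeff-tSym-≡ k l eq) (sym (trans
          (+-cong (δ*δ-diag a b) (trans (*-congʳ (δ-off (≢-sym a≢b))) (zeroˡ _)))
          (+-identityʳ 1#)))
  ...   | inj₂ (≡.refl , ≡.refl) = trans (coeff-tSym-≡ k l eq) (sym (trans
          (+-cong (trans (*-congʳ (δ-off a≢b)) (zeroˡ _)) (δ*δ-diag b a))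
          (+-identityˡ 1#)))

  infix 4 _≈ₘ_
  _≈ₘ_ : (Fin n → Fin n → Carrier) → (Fin n → Fin n → Carrier) → Set ℓ
  g ≈ₘ h = ∀ k l → g k l ≈ h k l

  formCoeff : (Fin n → Fin n → Carrier) → Monomial → Carrier
  formCoeff g m = sum λ k → sum λ l → g k l * coeff (tSym k l) m

  formCoeff-cong : ∀ {g h} → g ≈ₘ h → ∀ m → formCoeff g m ≈ formCoeff h m
  formCoeff-cong g≈h m = sum-cong-≋ λ k → sum-cong-≋ λ l → *-congʳ (g≈h k l)

  formCoeff-linear : ∀ {p} (a : Fin p → Carrier) (g : Fin p → Fin n → Fin n → Carrier) m →
    sum (λ i → a i * formCoeff (g i) m) ≈ formCoeff (λ k l → sum λ i → a i * g i k l) m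
  formCoeff-linear a g m = begin
    sum (λ i → a i * sum (λ k → sum (λ l → g i k l * T k l)))
      ≈⟨ sum-cong-≋ (λ i → trans (*-distribˡ-sum (a i) (λ k → sum (λ l → g i k l * T k l)))
                                   (sum-cong-≋ λ k → *-distribˡ-sum (a i) (λ l → g i k l * T k l))) ⟩
    sum (λ i → sum (λ k → sum (λ l → a i * (g i k l * T k l))))
      ≈⟨ ∑-comm (λ i k → sum (λ l → a i * (g i k l * T k l))) ⟩
    sum (λ k → sum (λ i → sum (λ l → a i * (g i k l * T k l))))
      ≈⟨ sum-cong-≋ (λ k → ∑-comm (λ i l → a i * (g i k l * T k l))) ⟩
    sum (λ k → sum (λ l → sum (λ i → a i * (g i k l * T k l))))
      ≈⟨ sum-cong-≋ (λ k → sum-cong-≋ λ l → trans (sum-cong-≋ λ i → sym (*-assoc (a i) (g i k l) (T k l)))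
                                                   (sym (*-distribʳ-sum (T k l) (λ i → a i * g i k l)))) ⟩
    sum (λ k → sum (λ l → sum (λ i → a i * g i k l) * T k l)) ∎
    where
    T : Fin n → Fin n → Carrier
    T k l = coeff (tSym k l) m

  formCoeff-diag : ∀ g a → formCoeff g (tMono a a) ≈ g a a
  formCoeff-diag g a = trans (sum-cong-≋ λ k → sum-cong-≋ λ l → *-congˡ (coeff-tSym-diag a k l))
                             (∑∑-δ*δ g a a)

  formCoeff-off : ∀ g → (∀ k l → g k l ≈ g l k) → ∀ {a b} → a ≢ b →
                  formCoeff g (tMono a b) ≈ g a b + g a b
  formCoeff-off g g-sym {a} {b} a≢b = begin
    formCoeff g (tMono a b)
      ≈⟨ sum-cong-≋ (λ k → sum-cong-≋ λ l → trans (*-congˡ (coeff-tSym-off a≢b k l)) (distribˡ _ _ _)) ⟩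
    sum (λ k → sum (λ l → g k l * (δ a k * δ b l) + g k l * (δ b k * δ a l)))
      ≈⟨ trans (sum-cong-≋ λ k → ∑-distrib-+ (λ l → g k l * (δ a k * δ b l)) (λ l → g k l * (δ b k * δ a l)))
               (∑-distrib-+ (λ k → sum (λ l → g k l * (δ a k * δ b l)))
                            (λ k → sum (λ l → g k l * (δ b k * δ a l)))) ⟩
    sum (λ k → sum (λ l → g k l * (δ a k * δ b l))) + sum (λ k → sum (λ l → g k l * (δ b k * δ a l)))
      ≈⟨ +-cong (∑∑-δ*δ g a b) (trans (∑∑-δ*δ g b a) (g-sym b a)) ⟩
    g a b + g a b ∎

  coeff-· : ∀ x y m → coeff (x · y) m ≈ formCoeff (λ k l → x k * y l) m
  coeff-· x y m = trans (coeff-ΣR (λ k → ΣR λ l → (x k * y l) •R tSym k l) m)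
                  (sum-cong-≋ λ k → trans (coeff-ΣR (λ l → (x k * y l) •R tSym k l) m)
                    (sum-cong-≋ λ l → coeff-•R (x k * y l) (tSym k l) m))

  gram : ∀ {p} → (Fin p → Carrier) → (Fin p → V) → Fin n → Fin n → Carrier
  gram λs e k l = sum λ i → λs i * (e i k * e i l)

  gram-sym : ∀ {p} (λs : Fin p → Carrier) e k l → gram λs e k l ≈ gram λs e l k
  gram-sym λs e k l = sum-cong-≋ λ i → *-congˡ (*-comm (e i k) (e i l))

  coeff-ΣN : ∀ {p} (λs : Fin p → Carrier) e m → coeff (ΣN λs e) m ≈ formCoeff (gram λs e) m
  coeff-ΣN λs e m = begin
    coeff (ΣN λs e) m
      ≈⟨ coeff-ΣR (λ i → λs i •R N (e i)) m ⟩
    sum (λ i → coeff (λs i •R N (e i)) m)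
      ≈⟨ sum-cong-≋ (λ i → trans (coeff-•R (λs i) (N (e i)) m) (*-congˡ (coeff-· (e i) (e i) m))) ⟩
    sum (λ i → λs i * formCoeff (λ k l → e i k * e i l) m)
      ≈⟨ formCoeff-linear λs (λ i k l → e i k * e i l) m ⟩
    formCoeff (gram λs e) m ∎

  coeff-ΣNp : ∀ {p} (λs : Fin p → Carrier) e y k m →
              coeff (ΣNp λs e y k) m ≈ formCoeff (λ k' l → gram λs e k k' * y l) m
  coeff-ΣNp λs e y k m = begin
    coeff (ΣNp λs e y k) m
      ≈⟨ coeff-ΣR (λ i → λs i •R Np (e i) y k) m ⟩
    sum (λ i → coeff (λs i •R Np (e i) y k) m)
      ≈⟨ sum-cong-≋ (λ i → trans (coeff-•R (λs i) (Np (e i) y k) m) (trans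
           (*-congˡ (trans (coeff-•R (e i k) (e i · y) m) (*-congˡ (coeff-· (e i) y m))))
           (sym (*-assoc (λs i) (e i k) _)))) ⟩
    sum (λ i → (λs i * e i k) * formCoeff (λ k' l → e i k' * y l) m)
      ≈⟨ formCoeff-linear (λ i → λs i * e i k) (λ i k' l → e i k' * y l) m ⟩
    formCoeff (λ k' l → sum λ i → (λs i * e i k) * (e i k' * y l)) m
      ≈⟨ formCoeff-cong (λ k' l → trans (sum-cong-≋ λ i → reassociate (λs i) (e i k) (e i k') (y l))
                                         (sym (*-distribʳ-sum (y l) (λ i → λs i * (e i k * e i k'))))) m ⟩
    formCoeff (λ k' l → gram λs e k k' * y l) m ∎
    where
    reassociate : ∀ a b c' d → (a * b) * (c' * d) ≈ (a * (b * c')) * d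
    reassociate a b c' d = trans (sym (*-assoc _ _ _)) (*-congʳ (*-assoc _ _ _))

  module Comparison {p p'} (λs : Fin p → Carrier) (λs' : Fin p' → Carrier) (e : Fin p → V) (e' : Fin p' → V) where

    gram≈⇒ΣN≈ : gram λs e ≈ₘ gram λs' e' → ΣN λs e ≈R ΣN λs' e'
    gram≈⇒ΣN≈ G≈G' m = trans (coeff-ΣN λs e m) (trans (formCoeff-cong G≈G' m) (sym (coeff-ΣN λs' e' m)))

    gram≈⇒ΣNp≈ : gram λs e ≈ₘ gram λs' e' → ΣNp λs e ≈Map ΣNp λs' e'
    gram≈⇒ΣNp≈ G≈G' y k m = trans (coeff-ΣNp λs e y k m) (trans
      (formCoeff-cong (λ k' l → *-congʳ (G≈G' k k')) m) (sym (coeff-ΣNp λs' e' y k m)))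

    ΣN≈⇒formCoeff≈ : ΣN λs e ≈R ΣN λs' e' → ∀ m → formCoeff (gram λs e) m ≈ formCoeff (gram λs' e') m
    ΣN≈⇒formCoeff≈ ΣN≈ m = trans (sym (coeff-ΣN λs e m)) (trans (ΣN≈ m) (coeff-ΣN λs' e' m))

    ΣN≈⇒gram≈ : CharNot2 → ΣN λs e ≈R ΣN λs' e' → gram λs e ≈ₘ gram λs' e'
    ΣN≈⇒gram≈ ch ΣN≈ a b with a ≟ b
    ... | yes ≡.refl = trans (sym (formCoeff-diag _ a))
                         (trans (ΣN≈⇒formCoeff≈ ΣN≈ (tMono a a)) (formCoeff-diag _ a))
    ... | no a≢b = double-injective ch (trans (sym (formCoeff-off _ (gram-sym λs e) a≢b))
                     (trans (ΣN≈⇒formCoeff≈ ΣN≈ (tMono a b)) (formCoeff-off _ (gram-sym λs' e') a≢b)))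

    ΣNp≈⇒gram≈ : ΣNp λs e ≈Map ΣNp λs' e' → gram λs e ≈ₘ gram λs' e'
    ΣNp≈⇒gram≈ ΣNp≈ k a = trans (sym (column λs e)) (trans (ΣNp≈ (δ a) k (tMono a a)) (column λs' e'))
      where
      column : ∀ {q} (μs : Fin q → Carrier) f → coeff (ΣNp μs f (δ a) k) (tMono a a) ≈ gram μs f k a
      column μs f = trans (coeff-ΣNp μs f (δ a) k (tMono a a)) (trans (formCoeff-diag _ a)
                      (trans (*-congˡ (reflexive (δ-diag a))) (*-identityʳ _)))

lemma2p9 : ∀ {c ℓ : Level} (K : Field c ℓ) (n : ℕ) →
    let open Setup K n in
    CharNot2 →
    (p p' : ℕ) (e : Fin p → V) (e' : Fin p' → V)
    (λs : Fin p → Field.Carrier K) (λs' : Fin p' → Field.Carrier K) →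
    (ΣN λs e ≈R ΣN λs' e') ⇔ (ΣNp λs e ≈Map ΣNp λs' e')
lemma2p9 K n ch p p' e e' λs λs' =
  mk⇔ (λ ΣN≈  → gram≈⇒ΣNp≈ (ΣN≈⇒gram≈ ch ΣN≈))
      (λ ΣNp≈ → gram≈⇒ΣN≈ (ΣNp≈⇒gram≈ ΣNp≈))
  where open GramMatrix.Comparison K n λs λs' e e'
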